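{- Let $G$ be a self-contained graph, $H \in \mathrm{Rem}(G)$, and suppose $\mathrm{Tor}_G(H) \neq \emptyset$. Then $\mathrm{Fnd}(G)$ is a self-contained graph which has a removable subgraph $P$ isomorphic to $\mathrm{Tor}_G(H)$.
   Context: All graphs are simple; $\emptyset$ denotes the null graph (no vertices). A self-contained graph is an infinite graph which is isomorphic to one of its proper induced subgraphs. For an induced subgraph $H$ of $G$, $G \setminus H$ denotes $G[V(G)\setminus V(H)]$. For a self-contained graph $G$, a removable subgraph of $G$ is a proper induced subgraph $H$ of $G$ with $V(H)\neq\emptyset$ such that $G\setminus H \cong G$; $\mathrm{Rem}(G)$ is the set of removable subgraphs. The foundation $\mathrm{Fnd}(G)=\bigcap_{H\in\mathrm{Rem}(G)} G\setminus H$ is the induced subgraph of $G$ on the vertices lying in no removable subgraph of $G$; for $H\in\mathrm{Rem}(G)$ the graph $G\setminus H\cong G$ is self-contained so $\mathrm{Fnd}(G\setminus H)$ is defined likewise. For $H\in\mathrm{Rem}(G)$, a vertex $v$ of $G$ is a twisted vertex for $H$ if there exists $P\in\mathrm{Rem}(G)$ with $v\in V(P)$ and $v\in V(\mathrm{Fnd}(G\setminus H))$; the torsion $\mathrm{Tor}_G(H)$ is the subgraph of $G$ induced by all twisted vertices for $H$. -}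

module Defs where

open import Level using (Level; _⊔_; Lift; lift; lower) renaming (suc to lsuc)
open import Data.Nat using (ℕ)
open import Data.Fin using (Fin)
open import Data.Product using (Σ; Σ-syntax; _×_; _,_; proj₁; proj₂)
open import Relation.Nullary using (¬_)
open import Relation.Binary.PropositionalEquality using (_≡_)
open import Relation.Binary using (IsEquivalence)

record Graph (a : Level) : Set (lsuc a) where
  field
    V        : Set a
    _≈_      : V → V → Set a
    isEquiv  : IsEquivalence _≈_
    E        : V → V → Set a
    E-resp   : ∀ {u u′ v v′} → u ≈ u′ → v ≈ v′ → E u v → E u′ v′
    E-sym    : ∀ {u v} → E u v → E v u
    E-irrefl : ∀ {v} → ¬ E v v

open Graph public

record Subset {a : Level} (G : Graph a) (p : Level) : Set (a ⊔ lsuc p) where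
  field
    mem      : V G → Set p
    mem-resp : ∀ {u v} → _≈_ G u v → mem u → mem v

open Subset public

_[_] : ∀ {a p} (G : Graph a) → Subset G p → Graph (a ⊔ p)
_[_] {a} {p} G S = record
  { V        = Σ (V G) (mem S)
  ; _≈_      = λ x y → Lift p (_≈_ G (proj₁ x) (proj₁ y))
  ; isEquiv  = record
      { refl  = lift (IsEquivalence.refl (isEquiv G))
      ; sym   = λ x → lift (IsEquivalence.sym (isEquiv G) (lower x))
      ; trans = λ x y → lift (IsEquivalence.trans (isEquiv G) (lower x) (lower y)) }
  ; E        = λ x y → Lift p (E G (proj₁ x) (proj₁ y))
  ; E-resp   = λ x y e → lift (E-resp G (lower x) (lower y) (lower e))
  ; E-sym    = λ e → lift (E-sym G (lower e))
  ; E-irrefl = λ e → E-irrefl G (lower e)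
  }

∁ : ∀ {a p} {G : Graph a} → Subset G p → Subset G p
∁ {G = G} S = record
  { mem      = λ v → ¬ mem S v
  ; mem-resp = λ u≈v ¬Su Sv → ¬Su (mem-resp S (IsEquivalence.sym (isEquiv G) u≈v) Sv)
  }

_∖_ : ∀ {a p} (G : Graph a) → Subset G p → Graph (a ⊔ p)
G ∖ S = G [ ∁ S ]

record _≅_ {a b : Level} (G₁ : Graph a) (G₂ : Graph b) : Set (a ⊔ b) where
  field
    to      : V G₁ → V G₂
    from    : V G₂ → V G₁
    to-resp   : ∀ {x y} → _≈_ G₁ x y → _≈_ G₂ (to x) (to y)
    from-resp : ∀ {x y} → _≈_ G₂ x y → _≈_ G₁ (from x) (from y)
    from-to : ∀ x → _≈_ G₁ (from (to x)) x
    to-from : ∀ y → _≈_ G₂ (to (from y)) y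
    to-E    : ∀ {x y} → E G₁ x y → E G₂ (to x) (to y)
    from-E  : ∀ {x y} → E G₂ x y → E G₁ (from x) (from y)

Finite : ∀ {a} → Graph a → Set a
Finite G = Σ[ n ∈ ℕ ] Σ[ f ∈ (Fin n → V G) ] Σ[ g ∈ (V G → Fin n) ]
  ((∀ {u v} → _≈_ G u v → g u ≡ g v) ×
   (∀ v → _≈_ G (f (g v)) v) ×
   (∀ i → g (f i) ≡ i))

Infinite : ∀ {a} → Graph a → Set a
Infinite G = ¬ Finite G

NonEmpty : ∀ {a p} {G : Graph a} → Subset G p → Set (a ⊔ p)
NonEmpty {G = G} S = Σ[ v ∈ V G ] mem S v

Proper : ∀ {a p} {G : Graph a} → Subset G p → Set (a ⊔ p)
Proper {G = G} S = Σ[ v ∈ V G ] ¬ mem S v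

SelfContained : ∀ {a} → Graph a → Set (lsuc a)
SelfContained {a} G = Infinite G × Σ[ S ∈ Subset G a ] (Proper S × (G [ S ]) ≅ G)

Removable : ∀ {a p} (G : Graph a) → Subset G p → Set (a ⊔ p)
Removable G S = Proper S × NonEmpty S × (G ∖ S) ≅ G

FndSet : ∀ {a} (G : Graph a) → Subset G (lsuc a)
FndSet {a} G = record
  { mem      = λ v → (S : Subset G a) → Removable G S → ¬ mem S v
  ; mem-resp = λ u≈v h S rS Sv → h S rS (mem-resp S (IsEquivalence.sym (isEquiv G) u≈v) Sv)
  }

Fnd : ∀ {a} → Graph a → Graph (lsuc a)
Fnd G = G [ FndSet G ]

TorSet : ∀ {a} (G : Graph a) (H : Subset G a) → Subset G (lsuc a)
TorSet {a} G H = record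
  { mem      = λ v → (Σ[ P ∈ Subset G a ] (Removable G P × mem P v))
                   × (Σ[ nh ∈ ¬ mem H v ] mem (FndSet (G ∖ H)) (v , nh))
  ; mem-resp = λ {u} {v} u≈v → λ where
      ((P , rP , Pu) , (nh , fu)) →
        (P , rP , mem-resp P u≈v Pu) ,
        (mem-resp (∁ H) u≈v nh , mem-resp (FndSet (G ∖ H)) {u , nh} {v , mem-resp (∁ H) u≈v nh} (lift u≈v) fu)
  }

Tor : ∀ {a} (G : Graph a) (H : Subset G a) → Graph (lsuc a)
Tor G H = G [ TorSet G H ]

module Submission where

-- Let φ : G ∖ H ≅ G witness that H is removable.
--   (1) Isomorphisms preserve foundations, so φ restricts to Fnd(G ∖ H) ≅ Fnd G.
--   (2) Fnd G ⊆ Fnd(G ∖ H): a removable subgraph S of G ∖ H yields the removable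
--       subgraph H ∪ S of G, so a vertex in no removable subgraph of G is in none of G ∖ H.
--   (3) Hence Fnd(G ∖ H) is the disjoint union of Fnd G and Tor_G(H): a vertex of
--       Fnd(G ∖ H) is twisted exactly when it lies in some removable subgraph of G.
-- Transporting Tor_G(H) along φ gives a vertex set P of Fnd G with Fnd G [P] ≅ Tor_G(H)
-- and Fnd G ∖ P ≅ Fnd G, so P is removable in Fnd G; and a graph with a removable
-- subgraph is self-contained, its infiniteness being a pigeonhole argument.

open import Defs
open import Level using (Level; lift; lower; _⊔_) renaming (suc to lsuc)
open import Data.Product using (Σ-syntax; _×_; _,_; proj₁; proj₂)
open import Data.Sum using (_⊎_; inj₁; inj₂)
open import Data.Nat using (suc)
open import Data.Nat.Properties using (n≮n)
open import Data.Fin using (Fin; punchOut)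
open import Data.Fin.Properties using (punchOut-injective; injective⇒≤)
open import Relation.Nullary using (¬_)
open import Relation.Binary using (IsEquivalence; Setoid)
open import Relation.Binary.PropositionalEquality using (_≡_; _≢_; sym; trans)
import Relation.Binary.Reasoning.Setoid as SetoidReasoning

open _≅_

setoid : ∀ {a} → Graph a → Setoid a a
setoid G = record { Carrier = V G ; _≈_ = _≈_ G ; isEquivalence = isEquiv G }

module _ {a} (G : Graph a) where
  ≈-refl : ∀ {x} → _≈_ G x x
  ≈-refl = IsEquivalence.refl (isEquiv G)

  ≈-sym : ∀ {x y} → _≈_ G x y → _≈_ G y x
  ≈-sym = IsEquivalence.sym (isEquiv G)

  ≈-trans : ∀ {x y z} → _≈_ G x y → _≈_ G y z → _≈_ G x z
  ≈-trans = IsEquivalence.trans (isEquiv G)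

≅-refl : ∀ {a} {A : Graph a} → A ≅ A
≅-refl {A = A} = record
  { to = λ x → x ; from = λ x → x ; to-resp = λ e → e ; from-resp = λ e → e
  ; from-to = λ _ → ≈-refl A ; to-from = λ _ → ≈-refl A ; to-E = λ e → e ; from-E = λ e → e }

≅-sym : ∀ {a b} {A : Graph a} {B : Graph b} → A ≅ B → B ≅ A
≅-sym ψ = record
  { to = from ψ ; from = to ψ ; to-resp = from-resp ψ ; from-resp = to-resp ψ
  ; from-to = to-from ψ ; to-from = from-to ψ ; to-E = from-E ψ ; from-E = to-E ψ }

≅-trans : ∀ {a b c} {A : Graph a} {B : Graph b} {C : Graph c} → A ≅ B → B ≅ C → A ≅ C
≅-trans {A = A} {C = C} ψ χ = record
  { to = λ x → to χ (to ψ x) ; from = λ z → from ψ (from χ z)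
  ; to-resp = λ e → to-resp χ (to-resp ψ e) ; from-resp = λ e → from-resp ψ (from-resp χ e)
  ; from-to = λ x → ≈-trans A (from-resp ψ (from-to χ (to ψ x))) (from-to ψ x)
  ; to-from = λ z → ≈-trans C (to-resp χ (to-from ψ (from χ z))) (to-from χ z)
  ; to-E = λ e → to-E χ (to-E ψ e) ; from-E = λ e → from-E ψ (from-E χ e) }

record _↪_ {a g} (A : Graph a) (G : Graph g) : Set (a ⊔ g) where
  field
    embed     : V A → V G
    embed-≈   : ∀ {x y} → _≈_ A x y → _≈_ G (embed x) (embed y)
    reflect-≈ : ∀ {x y} → _≈_ G (embed x) (embed y) → _≈_ A x y
    embed-E   : ∀ {x y} → E A x y → E G (embed x) (embed y)
    reflect-E : ∀ {x y} → E G (embed x) (embed y) → E A x y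

open _↪_

sub↪ : ∀ {a p} {G : Graph a} (S : Subset G p) → (G [ S ]) ↪ G
sub↪ S = record
  { embed = proj₁ ; embed-≈ = lower ; reflect-≈ = lift ; embed-E = lower ; reflect-E = lift }

⊆↪ : ∀ {a p q} {G : Graph a} (S : Subset G p) (U : Subset G q)
  → (∀ {v} → mem S v → mem U v) → (G [ S ]) ↪ (G [ U ])
⊆↪ S U S⊆U = record
  { embed = λ x → proj₁ x , S⊆U (proj₂ x)
  ; embed-≈ = λ e → lift (lower e) ; reflect-≈ = λ e → lift (lower e)
  ; embed-E = λ e → lift (lower e) ; reflect-E = λ e → lift (lower e) }

_∘↪_ : ∀ {a b c} {A : Graph a} {B : Graph b} {C : Graph c} → B ↪ C → A ↪ B → A ↪ C
ε ∘↪ δ = record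
  { embed = λ x → embed ε (embed δ x)
  ; embed-≈ = λ e → embed-≈ ε (embed-≈ δ e) ; reflect-≈ = λ e → reflect-≈ δ (reflect-≈ ε e)
  ; embed-E = λ e → embed-E ε (embed-E δ e) ; reflect-E = λ e → reflect-E δ (reflect-E ε e) }

restrict : ∀ {a b g h} {A : Graph a} {B : Graph b} {G₁ : Graph g} {G₂ : Graph h}
  (eA : A ↪ G₁) (eB : B ↪ G₂) (ψ : G₁ ≅ G₂) (f : V A → V B) (f′ : V B → V A)
  → (∀ x → _≈_ G₂ (embed eB (f x)) (to ψ (embed eA x)))
  → (∀ y → _≈_ G₁ (embed eA (f′ y)) (from ψ (embed eB y)))
  → A ≅ B
restrict {G₁ = G₁} {G₂} eA eB ψ f f′ f-agrees f′-agrees = record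
  { to = f ; from = f′
  ; to-resp = λ {x} {y} e → reflect-≈ eB
      (≈-trans G₂ (f-agrees x) (≈-trans G₂ (to-resp ψ (embed-≈ eA e)) (≈-sym G₂ (f-agrees y))))
  ; from-resp = λ {x} {y} e → reflect-≈ eA
      (≈-trans G₁ (f′-agrees x) (≈-trans G₁ (from-resp ψ (embed-≈ eB e)) (≈-sym G₁ (f′-agrees y))))
  ; from-to = λ x → reflect-≈ eA (round-trip₁ x)
  ; to-from = λ y → reflect-≈ eB (round-trip₂ y)
  ; to-E = λ {x} {y} e → reflect-E eB
      (E-resp G₂ (≈-sym G₂ (f-agrees x)) (≈-sym G₂ (f-agrees y)) (to-E ψ (embed-E eA e)))
  ; from-E = λ {x} {y} e → reflect-E eA
      (E-resp G₁ (≈-sym G₁ (f′-agrees x)) (≈-sym G₁ (f′-agrees y)) (from-E ψ (embed-E eB e)))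
  }
  where
  round-trip₁ : ∀ x → _≈_ G₁ (embed eA (f′ (f x))) (embed eA x)
  round-trip₁ x = begin
    embed eA (f′ (f x))          ≈⟨ f′-agrees (f x) ⟩
    from ψ (embed eB (f x))      ≈⟨ from-resp ψ (f-agrees x) ⟩
    from ψ (to ψ (embed eA x))   ≈⟨ from-to ψ (embed eA x) ⟩
    embed eA x                   ∎
    where open SetoidReasoning (setoid G₁)

  round-trip₂ : ∀ y → _≈_ G₂ (embed eB (f (f′ y))) (embed eB y)
  round-trip₂ y = begin
    embed eB (f (f′ y))          ≈⟨ f-agrees (f′ y) ⟩
    to ψ (embed eA (f′ y))       ≈⟨ to-resp ψ (f′-agrees y) ⟩
    to ψ (from ψ (embed eB y))   ≈⟨ to-from ψ (embed eB y) ⟩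
    embed eB y                   ∎
    where open SetoidReasoning (setoid G₂)

preimage : ∀ {a b p} {A : Graph a} {B : Graph b} (f : V A → V B)
  → (∀ {x y} → _≈_ A x y → _≈_ B (f x) (f y)) → Subset B p → Subset A p
preimage f f-resp S = record { mem = λ x → mem S (f x) ; mem-resp = λ e → mem-resp S (f-resp e) }

removable-pullback : ∀ {a b p} {A : Graph a} {B : Graph b} (ψ : A ≅ B) (S : Subset B p)
  → Removable B S → Removable A (preimage (to ψ) (to-resp ψ) S)
removable-pullback {A = A} {B = B} ψ S ((b , b∉S) , (c , c∈S) , χ) =
  (from ψ b , λ s → b∉S (mem-resp S (to-from ψ b) s)) ,
  (from ψ c , mem-resp S (≈-sym B (to-from ψ c)) c∈S) ,
  ≅-trans complements (≅-trans χ (≅-sym ψ))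
  where
  complements : (A ∖ preimage (to ψ) (to-resp ψ) S) ≅ (B ∖ S)
  complements = restrict (sub↪ (∁ (preimage (to ψ) (to-resp ψ) S))) (sub↪ (∁ S)) ψ
    (λ x → to ψ (proj₁ x) , proj₂ x)
    (λ y → from ψ (proj₁ y) , λ s → proj₂ y (mem-resp S (to-from ψ (proj₁ y)) s))
    (λ _ → ≈-refl B) (λ _ → ≈-refl A)

fnd-transport : ∀ {a} {A B : Graph a} (ψ : A ≅ B) {x}
  → mem (FndSet A) x → mem (FndSet B) (to ψ x)
fnd-transport ψ x∈Fnd S S-rem S∋ψx =
  x∈Fnd (preimage (to ψ) (to-resp ψ) S) (removable-pullback ψ S S-rem) S∋ψx

_∪_ : ∀ {a} {G : Graph a} (H : Subset G a) → Subset (G ∖ H) a → Subset G a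
_∪_ {G = G} H S = record
  { mem = λ u → mem H u ⊎ Σ[ u∉H ∈ ¬ mem H u ] mem S (u , u∉H)
  ; mem-resp = λ { e (inj₁ h) → inj₁ (mem-resp H e h)
                 ; e (inj₂ (n , s)) → inj₂ (mem-resp (∁ H) e n , mem-resp S (lift e) s) } }

-- Removing H and then S from G ∖ H is removing H ∪ S from G; so if both steps are
-- removals, H ∪ S is removable in G.
removable-∪ : ∀ {a} (G : Graph a) (H : Subset G a) (S : Subset (G ∖ H) a)
  → Removable G H → Removable (G ∖ H) S → Removable G (H ∪ S)
removable-∪ G H S ((_ , (h , h∈H) , φ)) (((u , u∉H) , u∉S) , _ , χ) =
  (u , λ { (inj₁ h) → u∉H h ; (inj₂ (_ , s)) → u∉S (mem-resp S (lift (≈-refl G)) s) }) ,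
  (h , inj₁ h∈H) ,
  ≅-trans stepwise (≅-trans χ φ)
  where
  stepwise : (G ∖ (H ∪ S)) ≅ ((G ∖ H) ∖ S)
  stepwise = restrict (sub↪ (∁ (H ∪ S))) (sub↪ (∁ H) ∘↪ sub↪ (∁ S)) ≅-refl
    (λ x → (proj₁ x , λ h → proj₂ x (inj₁ h)) , λ s → proj₂ x (inj₂ (_ , s)))
    (λ y → proj₁ (proj₁ y) , λ { (inj₁ h) → proj₂ (proj₁ y) h
                               ; (inj₂ (_ , s)) → proj₂ y (mem-resp S (lift (≈-refl G)) s) })
    (λ _ → ≈-refl G) (λ _ → ≈-refl G)

fnd-restrict : ∀ {a} (G : Graph a) (H : Subset G a) → Removable G H → ∀ {v}
  → mem (FndSet G) v → (v∉H : ¬ mem H v) → mem (FndSet (G ∖ H)) (v , v∉H)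
fnd-restrict G H H-rem v∈Fnd v∉H S S-rem v∈S =
  v∈Fnd (H ∪ S) (removable-∪ G H S H-rem S-rem) (inj₂ (v∉H , v∈S))

fnd-disjoint-tor : ∀ {a} (G : Graph a) (H : Subset G a) {v}
  → mem (FndSet G) v → ¬ mem (TorSet G H) v
fnd-disjoint-tor G H v∈Fnd ((P , P-rem , v∈P) , _) = v∈Fnd P P-rem v∈P

fnd-complement-tor : ∀ {a} (G : Graph a) (H : Subset G a) {v} (v∉H : ¬ mem H v)
  → mem (FndSet (G ∖ H)) (v , v∉H) → ¬ mem (TorSet G H) v → mem (FndSet G) v
fnd-complement-tor G H v∉H v∈Fnd′ v∉Tor S S-rem v∈S = v∉Tor ((S , S-rem , v∈S) , v∉H , v∈Fnd′)

injection-surjective : ∀ {n} (h : Fin n → Fin n) → (∀ {i j} → h i ≡ h j → i ≡ j)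
  → (p : Fin n) → ¬ (∀ i → h i ≢ p)
injection-surjective {suc m} h h-inj p misses = n≮n m (injective⇒≤ squeezed-injective)
  where
  squeezed : Fin (suc m) → Fin m
  squeezed i = punchOut {i = p} (λ eq → misses i (sym eq))

  squeezed-injective : ∀ {i j} → squeezed i ≡ squeezed j → i ≡ j
  squeezed-injective {i} {j} eq =
    h-inj (punchOut-injective (λ e → misses i (sym e)) (λ e → misses j (sym e)) eq)

removal-infinite : ∀ {a p} (A : Graph a) (S : Subset A p)
  → NonEmpty S → (A ∖ S) ≅ A → Infinite A
removal-infinite A S (p , p∈S) ι (n , f , g , g-resp , fg≈id , gf≡id) =
  injection-surjective h h-injective (g p) h-misses
  where
  -- h reads Fin n as the vertices of A and sends each to its copy in A ∖ S.
  h : Fin n → Fin n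
  h i = g (proj₁ (from ι (f i)))

  g-reflects : ∀ {u v} → g u ≡ g v → _≈_ A u v
  g-reflects {u} {v} eq = ≈-trans A (≈-sym A (fg≈id u)) (≈-trans A (f∘g-resp eq) (fg≈id v))
    where
    f∘g-resp : ∀ {u v} → g u ≡ g v → _≈_ A (f (g u)) (f (g v))
    f∘g-resp eq rewrite eq = ≈-refl A

  h-injective : ∀ {i j} → h i ≡ h j → i ≡ j
  h-injective {i} {j} eq = trans (sym (gf≡id i)) (trans (g-resp fi≈fj) (gf≡id j))
    where
    copies≈ : _≈_ A (proj₁ (from ι (f i))) (proj₁ (from ι (f j)))
    copies≈ = g-reflects eq

    fi≈fj : _≈_ A (f i) (f j)
    fi≈fj = ≈-trans A (≈-sym A (to-from ι (f i)))
              (≈-trans A (to-resp ι (lift copies≈)) (to-from ι (f j)))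

  h-misses : ∀ i → h i ≢ g p
  h-misses i eq = proj₂ (from ι (f i)) (mem-resp S (≈-sym A copy≈p) p∈S)
    where
    copy≈p : _≈_ A (proj₁ (from ι (f i))) p
    copy≈p = g-reflects eq

removable⇒selfContained : ∀ {a} (A : Graph a) (S : Subset A a)
  → Removable A S → SelfContained A
removable⇒selfContained A S (_ , (v , v∈S) , ι) =
  removal-infinite A S (v , v∈S) ι , ∁ S , (v , λ v∉S → v∉S v∈S) , ι

module Torsion {a} (G : Graph a) (H : Subset G a) (H-rem : Removable G H) where

  φ : (G ∖ H) ≅ G
  φ = proj₂ (proj₂ H-rem)

  fnd-avoids-H : ∀ {v} → mem (FndSet G) v → ¬ mem H v
  fnd-avoids-H v∈Fnd = v∈Fnd H H-rem

  fnd↪ : Fnd G ↪ (G ∖ H)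
  fnd↪ = ⊆↪ (FndSet G) (∁ H) fnd-avoids-H

  tor↪ : Tor G H ↪ (G ∖ H)
  tor↪ = ⊆↪ (TorSet G H) (∁ H) (λ t → proj₁ (proj₂ t))

  back : V (Fnd G) → V G
  back x = proj₁ (from φ (proj₁ x))

  -- P: the image of Tor_G(H) under φ, as a vertex set of Fnd G.
  P : Subset (Fnd G) (lsuc a)
  P = preimage back (λ e → lower (from-resp φ (lower e))) (TorSet G H)

  -- By (2) and (1), φ maps Fnd G (which avoids H) into Fnd G; by (1), φ⁻¹ maps
  -- Fnd G into Fnd(G ∖ H).
  forward : V (Fnd G) → V (Fnd G)
  forward (u , u∈Fnd) =
    to φ (u , fnd-avoids-H u∈Fnd) , fnd-transport φ (fnd-restrict G H H-rem u∈Fnd (fnd-avoids-H u∈Fnd))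

  backward-fnd : ∀ x → mem (FndSet (G ∖ H)) (from φ (proj₁ x))
  backward-fnd x = fnd-transport (≅-sym φ) (proj₂ x)

  complement≅ : (Fnd G ∖ P) ≅ Fnd G
  complement≅ = restrict (sub↪ (FndSet G) ∘↪ sub↪ (∁ P)) fnd↪ (≅-sym φ)
    (λ x → back (proj₁ x) , fnd-complement-tor G H _ (backward-fnd (proj₁ x)) (proj₂ x))
    (λ u → forward u , λ t → fnd-disjoint-tor G H (proj₂ u)
             (mem-resp (TorSet G H) (lower (from-to φ _)) t))
    (λ _ → lift (≈-refl G)) (λ _ → ≈-refl G)

  P≅Tor : (Fnd G [ P ]) ≅ Tor G H
  P≅Tor = restrict (sub↪ (FndSet G) ∘↪ sub↪ P) tor↪ (≅-sym φ)
    (λ x → back (proj₁ x) , proj₂ x)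
    (λ { (v , t) → (to φ (v , proj₁ (proj₂ t)) , fnd-transport φ (proj₂ (proj₂ t))) ,
                   mem-resp (TorSet G H) (≈-sym G (lower (from-to φ _))) t })
    (λ _ → lift (≈-refl G)) (λ _ → ≈-refl G)

  -- With Tor_G(H) nonempty, P is removable: nonempty via P≅Tor, and proper since
  -- a vertex of Fnd G ∖ P is precisely a witness of properness.
  P-removable : NonEmpty (TorSet G H) → Removable (Fnd G) P
  P-removable t = from complement≅ (proj₁ P-nonempty) , P-nonempty , complement≅
    where
    P-nonempty : NonEmpty P
    P-nonempty = from P≅Tor t

theorem3p6 : ∀ {a : Level} (G : Graph a) (H : Subset G a)
    → SelfContained G
    → Removable G H
    → NonEmpty (TorSet G H)
    → SelfContained (Fnd G)
      × (Σ[ P ∈ Subset (Fnd G) (lsuc a) ] (Removable (Fnd G) P × ((Fnd G) [ P ]) ≅ Tor G H))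
theorem3p6 G H _ H-rem tor-nonempty =
  removable⇒selfContained (Fnd G) P P-rem , P , P-rem , P≅Tor
  where
  open Torsion G H H-rem
  P-rem : Removable (Fnd G) P
  P-rem = P-removable tor-nonempty
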